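{- Every normal proof of $\mathsf{QMLL}$ is cut-free, i.e. if $\pi$ is a $\mathsf{QMLL}$ proof such that there is no proof $\rho$ with $\pi\Longrightarrow\rho$, then $\pi$ contains no instance of the cut rule $\mathsf{C}$.
   Context: $\mathsf{QMLL}$ formulas are generated by $A ::= \alpha \mid \alpha^\perp \mid A\wp A \mid A\otimes A \mid \boxdot A \mid \Diamond A$, where $\alpha$ ranges over atoms, $\wp$ (par) and $\otimes$ (tensor) are the multiplicative connectives, and $\boxdot,\Diamond$ are dual unary modalities. Linear negation is extended as usual: $(\alpha^\perp)^\perp=\alpha$, $(A\otimes B)^\perp=A^\perp\wp B^\perp$, $(A\wp B)^\perp=A^\perp\otimes B^\perp$, $(\boxdot A)^\perp=\Diamond A^\perp$, $(\Diamond A)^\perp=\boxdot A^\perp$. $\boxdot^n A$ (resp. $\Diamond^n A$) denotes $A$ prefixed by $n$ occurrences of $\boxdot$ (resp. $\Diamond$). A modal formula is one of the form $\boxdot A$ or $\Diamond A$. Sequents are $\vdash\Gamma$ with $\Gamma$ a finite multiset of formulas. $\mathcal U_n$ denotes the set of unitary operators on $\mathbb C^{2^n}$ and $I_n$ the identity in $\mathcal U_n$. The rules are: axiom $\mathsf{A}$: $\vdash A^\perp,A$; cut $\mathsf{C}$: from $\vdash\Gamma,A$ and $\vdash\Delta,A^\perp$ infer $\vdash\Gamma,\Delta$; par: from $\vdash\Gamma,A,B$ infer $\vdash\Gamma,A\wp B$; tensor: from $\vdash\Gamma,A$ and $\vdash\Delta,B$ infer $\vdash\Gamma,\Delta,A\otimes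 B$; quantum rule $\mathsf{Q}_n$ (labelled by some $U\in\mathcal U_n$): from $\vdash A,B$ infer $\vdash \Diamond^n A,\boxdot^n B$, provided $A,B$ are either both modal formulas or both non-modal formulas. A proof is a finite tree built from these rules. The reduction relation $\Longrightarrow$ on proofs is generated by the following steps, which may be applied to any subproof: (1) Axiom reduction: a cut between a proof of $\vdash\Gamma,A$ and the axiom $\vdash A^\perp,A$ reduces to the proof of $\vdash\Gamma,A$. (2) Multiplicative principal reduction: a cut between a tensor rule (premises $\vdash\Gamma,A$ and $\vdash\Delta,B$, conclusion $\vdash\Gamma,\Delta,A\otimes B$) and a par rule (premise $\vdash\Theta,A^\perp,B^\perp$, conclusion $\vdash\Theta,A^\perp\wp B^\perp$) reduces to a cut of $\vdash\Gamma,A$ with the cut of $\vdash\Delta,B$ and $\vdash\Theta,A^\perp,B^\perp$ (on $B$). (3) Quantum principal reduction: a cut between $\mathsf{Q}_m$ with premise $\vdash A,B$ and label $U$ (conclusion $\vdash\Diamond^mA,\boxdot^mB$) and $\mathsf{Q}_m$ with premise $\vdash B^\perp,C$ and label $V$ (conclusion $\vdash\Diamond^mB^\perp,\boxdot^mC$) reduces to $\mathsf{Q}_m$ with label $U\cdot V$ applied to the cut of $\vdash A,B$ and $\vdash B^\perp,C$. (4) Quantum $\eta$-expansion: an axiom $\vdash\Diamond^nA^\perp,\boxdot^nA$ reduces to $\mathsf{Q}_n$ with label $I_n$ applied to the axiom $\vdash A^\perp,A$. (5) Quantum contraction: $\mathsf{Q}_n$ with label $V$ applied to ($\mathsf{Q}_k$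 with label $U$ applied to a proof of $\vdash A,B$) reduces to $\mathsf{Q}_{k+n}$ with label $U\otimes V$ applied to that proof of $\vdash A,B$. (6) Commuting reductions: a cut of $\vdash\Gamma,A$ with a par rule deriving $\vdash\Delta,A^\perp,B\wp C$ from $\vdash\Delta,A^\perp,B,C$ reduces to the par rule applied to the cut of $\vdash\Gamma,A$ with $\vdash\Delta,A^\perp,B,C$; a cut of $\vdash\Gamma,A$ with a tensor rule deriving $\vdash\Delta,\Theta,A^\perp,B\otimes C$ from $\vdash\Delta,A^\perp,B$ and $\vdash\Theta,C$ reduces to the tensor rule applied to (cut of $\vdash\Gamma,A$ with $\vdash\Delta,A^\perp,B$) and $\vdash\Theta,C$; symmetrically when $A^\perp$ is in the right premise $\vdash\Theta,A^\perp,C$ of the tensor. A proof $\pi$ is normal if there is no $\rho$ with $\pi\Longrightarrow\rho$. -}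

module Defs where

open import Data.Nat using (ℕ; zero; suc; _+_)
open import Data.Bool using (Bool; true; false)
open import Data.List using (List; []; _∷_; _++_)
open import Data.List.Relation.Binary.Permutation.Propositional using (_↭_)
open import Data.Product using (∃)
open import Relation.Binary.PropositionalEquality using (_≡_)
open import Relation.Nullary using (¬_)

infixr 30 _⊗_ _⅋_

data Formula : Set where
  atom  : ℕ → Formula
  natom : ℕ → Formula
  _⅋_   : Formula → Formula → Formula
  _⊗_   : Formula → Formula → Formula
  □     : Formula → Formula     -- the box-dot modality ⊡
  ◇     : Formula → Formula

neg : Formula → Formula
neg (atom a)  = natom a
neg (natom a) = atom a
neg (A ⅋ B)   = neg A ⊗ neg B
neg (A ⊗ B)   = neg A ⅋ neg B
neg (□ A)     = ◇ (neg A)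
neg (◇ A)     = □ (neg A)

□^ : ℕ → Formula → Formula
□^ zero    A = A
□^ (suc n) A = □ (□^ n A)

◇^ : ℕ → Formula → Formula
◇^ zero    A = A
◇^ (suc n) A = ◇ (◇^ n A)

modal : Formula → Bool
modal (□ _) = true
modal (◇ _) = true
modal _     = false

-- Labels of the quantum rule.  In the paper Label n = 𝒰_n (unitaries on
-- ℂ^(2^n)), with composition U·V, tensor product U⊗V and identity I_n.
-- We abstract over any such data.

record LabelAlg : Set₁ where
  field
    Label : ℕ → Set
    _·_   : ∀ {n} → Label n → Label n → Label n
    _⊗ᴸ_  : ∀ {k n} → Label k → Label n → Label (k + n)
    Id    : (n : ℕ) → Label n

module QMLL (L : LabelAlg) where
  open LabelAlg L

  -- Proof trees (annotated with the formulas introduced / cut on)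
  data Proof : Set where
    ax  : Formula → Proof
    cut : Formula → Proof → Proof → Proof
    par : Formula → Formula → Proof → Proof
    ten : Formula → Formula → Proof → Proof → Proof
    Q   : (n : ℕ) → Label n → Formula → Formula → Proof → Proof

  -- π is a proof of the sequent ⊢ Γ  (Γ a multiset: lists up to permutation)
  data _⊢_ : Proof → List Formula → Set where
    ax   : ∀ {A} → ax A ⊢ (neg A ∷ A ∷ [])
    cut  : ∀ {A π σ Γ Δ} → π ⊢ (A ∷ Γ) → σ ⊢ (neg A ∷ Δ) → cut A π σ ⊢ (Γ ++ Δ)
    par  : ∀ {A B π Γ} → π ⊢ (A ∷ B ∷ Γ) → par A B π ⊢ (A ⅋ B ∷ Γ)
    ten  : ∀ {A B π σ Γ Δ} → π ⊢ (A ∷ Γ) → σ ⊢ (B ∷ Δ) → ten A B π σ ⊢ (A ⊗ B ∷ Γ ++ Δ)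
    Q    : ∀ {n U A B π} → modal A ≡ modal B → π ⊢ (A ∷ B ∷ []) →
           Q (suc n) U A B π ⊢ (◇^ (suc n) A ∷ □^ (suc n) B ∷ [])
    perm : ∀ {π Γ Δ} → π ⊢ Γ → Γ ↭ Δ → π ⊢ Δ

  data CutRed : Proof → Proof → Set where
    axiomR : ∀ {A X π} → CutRed (cut A π (ax X)) π
    multR  : ∀ {F A B A' B' π₁ π₂ σ} → F ≡ A ⊗ B → A' ≡ neg A → B' ≡ neg B →
             CutRed (cut F (ten A B π₁ π₂) (par A' B' σ)) (cut A π₁ (cut B π₂ σ))
    quantR : ∀ {m U V F A B B' C π σ} → F ≡ □^ m B → B' ≡ neg B →
             CutRed (cut F (Q m U A B π) (Q m V B' C σ)) (Q m (U · V) A C (cut B π σ))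
    comPar : ∀ {A B C π σ Δ} → σ ⊢ (neg A ∷ B ∷ C ∷ Δ) →
             CutRed (cut A π (par B C σ)) (par B C (cut A π σ))
    comTenL : ∀ {A B C π σ₁ σ₂ Δ} → σ₁ ⊢ (neg A ∷ B ∷ Δ) →
             CutRed (cut A π (ten B C σ₁ σ₂)) (ten B C (cut A π σ₁) σ₂)
    comTenR : ∀ {A B C π σ₁ σ₂ Θ} → σ₂ ⊢ (neg A ∷ C ∷ Θ) →
             CutRed (cut A π (ten B C σ₁ σ₂)) (ten B C σ₁ (cut A π σ₂))

  -- One-step reduction π ⟹ ρ, closed under subproofs.
  -- Cut is symmetric in its two premises: a cut reduces whenever it or its
  -- mirror image (premises exchanged) is a cut redex.
  data _⟹_ : Proof → Proof → Set where
    cutR    : ∀ {π ρ} → CutRed π ρ → π ⟹ ρ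
    cutRsym : ∀ {A π σ ρ} → CutRed (cut (neg A) σ π) ρ → cut A π σ ⟹ ρ
    etaR    : ∀ {n X A} → X ≡ □^ (suc n) A →
              ax X ⟹ Q (suc n) (Id (suc n)) (neg A) A (ax A)
    etaR'   : ∀ {n X A} → X ≡ ◇^ (suc n) A →
              ax X ⟹ Q (suc n) (Id (suc n)) A (neg A) (ax A)
    contrR  : ∀ {n k V U A B A' B' π} → A' ≡ ◇^ k A → B' ≡ □^ k B →
              Q n V A' B' (Q k U A B π) ⟹ Q (k + n) (U ⊗ᴸ V) A B π
    cutˡ : ∀ {A π π' σ} → π ⟹ π' → cut A π σ ⟹ cut A π' σ
    cutʳ : ∀ {A π σ σ'} → σ ⟹ σ' → cut A π σ ⟹ cut A π σ'
    parᶜ : ∀ {A B π π'} → π ⟹ π' → par A B π ⟹ par A B π'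
    tenˡ : ∀ {A B π π' σ} → π ⟹ π' → ten A B π σ ⟹ ten A B π' σ
    tenʳ : ∀ {A B π σ σ'} → σ ⟹ σ' → ten A B π σ ⟹ ten A B π σ'
    Qᶜ   : ∀ {n U A B π π'} → π ⟹ π' → Q n U A B π ⟹ Q n U A B π'

  Normal : Proof → Set
  Normal π = ∀ ρ → ¬ (π ⟹ ρ)

  data CutFree : Proof → Set where
    ax  : ∀ {A} → CutFree (ax A)
    par : ∀ {A B π} → CutFree π → CutFree (par A B π)
    ten : ∀ {A B π σ} → CutFree π → CutFree σ → CutFree (ten A B π σ)
    Q   : ∀ {n U A B π} → CutFree π → CutFree (Q n U A B π)

module Submission where

-- The only
-- interesting case is a cut  cut A π σ  whose premises are, by induction,
-- cut-free; we show that such a cut is ALWAYS reducible, contradicting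
-- normality.  To this end we look at the last rule of each cut-free premise
-- relative to the cut formula (`cut-view`):
--   * either the cut formula is not principal there (or the premise is an
--     axiom), and the cut is an axiom or commuting redex (`Commutes`);
--   * or it is principal (`Principal`): then two par/tensor premises form a
--     multiplicative redex, and two quantum rules form a quantum redex when
--     their depths agree.  When the depths differ, the modality of greater
--     depth leaks into the premise ⊢ A,B of one quantum rule, and that rule
--     then reduces on its own, by η-expansion of an axiom premise or by
--     quantum contraction with a quantum premise (`quantum-reducible`).

open import Defs
open import Data.Bool using (true)
open import Data.Empty using (⊥; ⊥-elim)
open import Data.List using (List; []; _∷_; _++_)
open import Data.List.Membership.Propositional using (_∈_)
open import Data.List.Membership.Propositional.Properties using (∈-∃++; ∈-++⁻)
open import Data.List.Relation.Binary.Permutation.Propositional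
  using (_↭_; ↭-refl; ↭-sym; ↭-trans)
open import Data.List.Relation.Binary.Permutation.Propositional.Properties
  using (∈-resp-↭; ++⁺ˡ; shift)
open import Data.List.Relation.Unary.Any using (here; there)
open import Data.Nat using (zero; suc)
open import Data.Product using (∃; ∃₂; _×_; _,_; proj₂)
open import Data.Sum using (_⊎_; inj₁; inj₂)
open import Relation.Binary.PropositionalEquality using (_≡_; refl; sym; trans; cong; cong₂)

neg-involutive : ∀ A → neg (neg A) ≡ A
neg-involutive (atom a)  = refl
neg-involutive (natom a) = refl
neg-involutive (A ⅋ B)   = cong₂ _⅋_ (neg-involutive A) (neg-involutive B)
neg-involutive (A ⊗ B)   = cong₂ _⊗_ (neg-involutive A) (neg-involutive B)
neg-involutive (□ A)     = cong □ (neg-involutive A)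
neg-involutive (◇ A)     = cong ◇ (neg-involutive A)

neg-◇^ : ∀ n A → neg (◇^ n A) ≡ □^ n (neg A)
neg-◇^ zero    A = refl
neg-◇^ (suc n) A = cong □ (neg-◇^ n A)

neg-□^ : ∀ n A → neg (□^ n A) ≡ ◇^ n (neg A)
neg-□^ zero    A = refl
neg-□^ (suc n) A = cong ◇ (neg-□^ n A)

data ◇-headed : Formula → Set where
  ◇-head : ∀ A → ◇-headed (◇ A)

data □-headed : Formula → Set where
  □-head : ∀ A → □-headed (□ A)

◇□-exclusive : ∀ {A} → ◇-headed A → □-headed A → ⊥
◇□-exclusive (◇-head _) ()

modal-headed : ∀ {A} → modal A ≡ true → ◇-headed A ⊎ □-headed A
modal-headed {□ A} _ = inj₂ (□-head A)
modal-headed {◇ A} _ = inj₁ (◇-head A)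

neg-◇-headed : ∀ {A} → ◇-headed (neg A) → □-headed A
neg-◇-headed {□ A} _ = □-head A

neg-□-headed : ∀ {A} → □-headed (neg A) → ◇-headed A
neg-□-headed {◇ A} _ = ◇-head A

◇-injective : ∀ {A B : Formula} → ◇ A ≡ ◇ B → A ≡ B
◇-injective refl = refl

□-injective : ∀ {A B : Formula} → □ A ≡ □ B → A ≡ B
□-injective refl = refl

◇^-cancel : ∀ m n {A B} → ◇^ m A ≡ ◇^ n B →
  (m ≡ n × A ≡ B) ⊎ (◇-headed A ⊎ ◇-headed B)
◇^-cancel zero    zero    e    = inj₁ (refl , e)
◇^-cancel zero    (suc n) refl = inj₂ (inj₁ (◇-head _))
◇^-cancel (suc m) zero    refl = inj₂ (inj₂ (◇-head _))
◇^-cancel (suc m) (suc n) e with ◇^-cancel m n (◇-injective e)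
... | inj₁ (refl , e) = inj₁ (refl , e)
... | inj₂ h          = inj₂ h

□^-cancel : ∀ m n {A B} → □^ m A ≡ □^ n B →
  (m ≡ n × A ≡ B) ⊎ (□-headed A ⊎ □-headed B)
□^-cancel zero    zero    e    = inj₁ (refl , e)
□^-cancel zero    (suc n) refl = inj₂ (inj₁ (□-head _))
□^-cancel (suc m) zero    refl = inj₂ (inj₂ (□-head _))
□^-cancel (suc m) (suc n) e with □^-cancel m n (□-injective e)
... | inj₁ (refl , e) = inj₁ (refl , e)
... | inj₂ h          = inj₂ h

-- The premise ⊢ P₁,P₂ of a quantum rule is "oriented" when P₁ is a ◇-formula
-- or P₂ a ⊡-formula; only then can a quantum premise be contracted into it.
Oriented : Formula → Formula → Set
Oriented P₁ P₂ = ◇-headed P₁ ⊎ □-headed P₂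

oriented-modal : ∀ {P₁ P₂} → Oriented P₁ P₂ → modal P₁ ≡ modal P₂ →
  modal P₁ ≡ true × modal P₂ ≡ true
oriented-modal (inj₁ (◇-head _)) agree = refl , sym agree
oriented-modal (inj₂ (□-head _)) agree = agree , refl

∈-pair : ∀ {X P₁ P₂ : Formula} → X ∈ P₁ ∷ P₂ ∷ [] → X ≡ P₁ ⊎ X ≡ P₂
∈-pair (here e)         = inj₁ e
∈-pair (there (here e)) = inj₂ e
∈-pair (there (there ()))

oriented-pair : ∀ {X Y P₁ P₂} → ◇-headed X → □-headed Y →
  X ∷ Y ∷ [] ↭ P₁ ∷ P₂ ∷ [] → Oriented P₁ P₂ → X ≡ P₁ × Y ≡ P₂
oriented-pair hX hY p o
  with ∈-pair (∈-resp-↭ p (here refl)) | ∈-pair (∈-resp-↭ p (there (here refl))) | o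
... | inj₁ X≡P₁  | inj₂ Y≡P₂  | _      = X≡P₁ , Y≡P₂
... | _          | inj₁ refl  | inj₁ h = ⊥-elim (◇□-exclusive h hY)
... | inj₂ refl  | _          | inj₂ h = ⊥-elim (◇□-exclusive hX h)
... | inj₂ refl  | inj₂ refl  | inj₁ _ = ⊥-elim (◇□-exclusive hX hY)
... | inj₁ refl  | inj₁ refl  | inj₂ _ = ⊥-elim (◇□-exclusive hX hY)

bring-to-front : ∀ {F : Formula} pre {Γ} → F ∈ Γ → ∃ λ Γ' → pre ++ Γ ↭ F ∷ pre ++ Γ'
bring-to-front {F} pre p with ys , zs , refl ← ∈-∃++ p =
  ys ++ zs , ↭-trans (++⁺ˡ pre (shift F ys zs)) (shift F pre (ys ++ zs))

module CutFreeness (L : LabelAlg) where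
  open QMLL L

  Reducible : Proof → Set
  Reducible π = ∃ λ ρ → π ⟹ ρ

  inv-ax : ∀ {X Γ} → ax X ⊢ Γ → neg X ∷ X ∷ [] ↭ Γ
  inv-ax ax         = ↭-refl
  inv-ax (perm d p) = ↭-trans (inv-ax d) p

  inv-par : ∀ {B C π Γ} → par B C π ⊢ Γ →
    ∃ λ Γ₀ → π ⊢ (B ∷ C ∷ Γ₀) × B ⅋ C ∷ Γ₀ ↭ Γ
  inv-par (par d) = _ , d , ↭-refl
  inv-par (perm d p) with Γ₀ , d' , q ← inv-par d = Γ₀ , d' , ↭-trans q p

  inv-ten : ∀ {B C π σ Γ} → ten B C π σ ⊢ Γ →
    ∃₂ λ Γ₁ Γ₂ → π ⊢ (B ∷ Γ₁) × σ ⊢ (C ∷ Γ₂) × B ⊗ C ∷ Γ₁ ++ Γ₂ ↭ Γ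
  inv-ten (ten d e) = _ , _ , d , e , ↭-refl
  inv-ten (perm d p) with Γ₁ , Γ₂ , d' , e' , q ← inv-ten d = Γ₁ , Γ₂ , d' , e' , ↭-trans q p

  inv-Q : ∀ {k U P₁ P₂ π Γ} → Q k U P₁ P₂ π ⊢ Γ →
    ∃ λ n → k ≡ suc n × modal P₁ ≡ modal P₂ × π ⊢ (P₁ ∷ P₂ ∷ []) ×
      ◇^ (suc n) P₁ ∷ □^ (suc n) P₂ ∷ [] ↭ Γ
  inv-Q (Q agree d) = _ , refl , agree , d , ↭-refl
  inv-Q (perm d p) with n , e , agree , d' , q ← inv-Q d = n , e , agree , d' , ↭-trans q p

  -- A cut-free quantum rule with an oriented premise reduces: its premise is
  -- either an axiom on a modal formula (η-expansion) or a quantum rule whose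
  -- conclusion matches the premise in order (quantum contraction).  Par and
  -- tensor cannot conclude a sequent of modal formulas.
  quantum-reducible : ∀ {k U P₁ P₂ π Γ} → CutFree (Q k U P₁ P₂ π) →
    Q k U P₁ P₂ π ⊢ Γ → Oriented P₁ P₂ → Reducible (Q k U P₁ P₂ π)
  quantum-reducible {P₁ = P₁} {P₂} (Q cf) d o
    with _ , _ , agree , dπ , _ ← inv-Q d = premise-reduces cf dπ
    where
    both-modal : ∀ {X} → X ∈ P₁ ∷ P₂ ∷ [] → modal X ≡ true
    both-modal x with ∈-pair x | oriented-modal o agree
    ... | inj₁ refl | m₁ , _ = m₁
    ... | inj₂ refl | _ , m₂ = m₂

    premise-reduces : ∀ {k U π} → CutFree π → π ⊢ (P₁ ∷ P₂ ∷ []) →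
      Reducible (Q k U P₁ P₂ π)
    premise-reduces {π = ax X} ax dπ
      with modal-headed (both-modal (∈-resp-↭ (inv-ax dπ) (there (here refl))))
    ... | inj₁ (◇-head A) = _ , Qᶜ (etaR' {n = zero} refl)
    ... | inj₂ (□-head A) = _ , Qᶜ (etaR {n = zero} refl)
    premise-reduces (par _) dπ
      with () ← both-modal (∈-resp-↭ (proj₂ (proj₂ (inv-par dπ))) (here refl))
    premise-reduces (ten _ _) dπ
      with _ , _ , _ , _ , q ← inv-ten dπ
      with () ← both-modal (∈-resp-↭ q (here refl))
    premise-reduces (Q _) dπ
      with _ , refl , _ , _ , q ← inv-Q dπ
      with e₁ , e₂ ← oriented-pair (◇-head _) (□-head _) q o = _ , contrR (sym e₁) (sym e₂)

  Commutes : Formula → Proof → Set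
  Commutes F σ = ∀ {X} → neg X ≡ F → ∀ π → ∃ λ ρ → CutRed (cut X π σ) ρ

  data Principal (F : Formula) : Proof → Set where
    par-principal : ∀ {B C σ} → F ≡ B ⅋ C → Principal F (par B C σ)
    ten-principal : ∀ {B C σ₁ σ₂} → F ≡ B ⊗ C → Principal F (ten B C σ₁ σ₂)
    Q◇-principal  : ∀ {n U S T σ} → F ≡ ◇^ (suc n) S → Principal F (Q (suc n) U S T σ)
    Q□-principal  : ∀ {n U S T σ} → F ≡ □^ (suc n) T → Principal F (Q (suc n) U S T σ)

  cut-view : ∀ {F σ Δ} → CutFree σ → σ ⊢ (F ∷ Δ) → Commutes F σ ⊎ Principal F σ
  cut-view ax _ = inj₁ λ _ _ → _ , axiomR
  cut-view (par {A = B} {C} _) d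
    with _ , d' , q ← inv-par d
    with ∈-resp-↭ (↭-sym q) (here refl)
  ... | here e = inj₂ (par-principal e)
  ... | there p
    with _ , r ← bring-to-front (B ∷ C ∷ []) p = inj₁ λ { refl _ → _ , comPar (perm d' r) }
  cut-view (ten {A = B} {C} _ _) d
    with Γ₁ , _ , d₁ , d₂ , q ← inv-ten d
    with ∈-resp-↭ (↭-sym q) (here refl)
  ... | here e = inj₂ (ten-principal e)
  ... | there p with ∈-++⁻ Γ₁ p
  ... | inj₁ p₁
    with _ , r ← bring-to-front (B ∷ []) p₁ = inj₁ λ { refl _ → _ , comTenL (perm d₁ r) }
  ... | inj₂ p₂
    with _ , r ← bring-to-front (C ∷ []) p₂ = inj₁ λ { refl _ → _ , comTenR (perm d₂ r) }
  cut-view (Q _) d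
    with _ , refl , _ , _ , q ← inv-Q d
    with ∈-pair (∈-resp-↭ (↭-sym q) (here refl))
  ... | inj₁ e = inj₂ (Q◇-principal e)
  ... | inj₂ e = inj₂ (Q□-principal e)

  -- A cut between two principal formulas reduces: par against tensor is a
  -- multiplicative redex, ◇ against ⊡ of equal depth a quantum redex, and of
  -- unequal depth one premise is a reducible quantum rule.
  principal-cut : ∀ {A π σ Γ Δ} → CutFree π → π ⊢ Γ → CutFree σ → σ ⊢ Δ →
    Principal A π → Principal (neg A) σ → Reducible (cut A π σ)
  principal-cut _ _ _ _ (par-principal {B} {C} refl) (ten-principal refl) =
    _ , cutRsym (multR refl (sym (neg-involutive B)) (sym (neg-involutive C)))
  principal-cut _ _ _ _ (ten-principal refl) (par-principal refl) =
    _ , cutR (multR refl refl refl)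
  principal-cut cfπ dπ cfσ dσ (Q◇-principal {n = m} {S = S} refl) (Q□-principal {n = n} eσ)
    with □^-cancel (suc m) (suc n) (trans (sym (neg-◇^ (suc m) S)) eσ)
  ... | inj₁ (refl , refl) = _ , cutRsym (quantR eσ (sym (neg-involutive S)))
  ... | inj₂ (inj₁ h)      = _ , cutˡ (proj₂ (quantum-reducible cfπ dπ (inj₁ (neg-□-headed h))))
  ... | inj₂ (inj₂ h)      = _ , cutʳ (proj₂ (quantum-reducible cfσ dσ (inj₂ h)))
  principal-cut cfπ dπ cfσ dσ (Q□-principal {n = m} {T = T} refl) (Q◇-principal {n = n} eσ)
    with ◇^-cancel (suc m) (suc n) (trans (sym (neg-□^ (suc m) T)) eσ)
  ... | inj₁ (refl , refl) = _ , cutR (quantR refl refl)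
  ... | inj₂ (inj₁ h)      = _ , cutˡ (proj₂ (quantum-reducible cfπ dπ (inj₂ (neg-◇-headed h))))
  ... | inj₂ (inj₂ h)      = _ , cutʳ (proj₂ (quantum-reducible cfσ dσ (inj₁ h)))
  principal-cut _ _ _ _ (par-principal refl) (par-principal ())
  principal-cut _ _ _ _ (par-principal refl) (Q◇-principal ())
  principal-cut _ _ _ _ (par-principal refl) (Q□-principal ())
  principal-cut _ _ _ _ (ten-principal refl) (ten-principal ())
  principal-cut _ _ _ _ (ten-principal refl) (Q◇-principal ())
  principal-cut _ _ _ _ (ten-principal refl) (Q□-principal ())
  principal-cut _ _ _ _ (Q◇-principal refl) (par-principal ())
  principal-cut _ _ _ _ (Q◇-principal refl) (ten-principal ())
  principal-cut _ _ _ _ (Q◇-principal refl) (Q◇-principal ())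
  principal-cut _ _ _ _ (Q□-principal refl) (par-principal ())
  principal-cut _ _ _ _ (Q□-principal refl) (ten-principal ())
  principal-cut _ _ _ _ (Q□-principal refl) (Q□-principal ())

  cut-reducible : ∀ {A π σ Γ Δ} → CutFree π → π ⊢ (A ∷ Γ) → CutFree σ → σ ⊢ (neg A ∷ Δ) →
    Reducible (cut A π σ)
  cut-reducible {A} {π} {σ} cfπ dπ cfσ dσ with cut-view cfπ dπ | cut-view cfσ dσ
  ... | _            | inj₁ σ-commutes = _ , cutR (proj₂ (σ-commutes refl π))
  ... | inj₁ π-commutes | _            = _ , cutRsym (proj₂ (π-commutes (neg-involutive A) σ))
  ... | inj₂ p          | inj₂ q       = principal-cut cfπ dπ cfσ dσ p q

  normal-below : ∀ {π π'} {f : Proof → Proof} →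
    (∀ {ρ} → π ⟹ ρ → π' ⟹ f ρ) → Normal π' → Normal π
  normal-below lift normal ρ r = normal _ (lift r)

  normal⇒cut-free : (π : Proof) (Γ : List Formula) → π ⊢ Γ → Normal π → CutFree π
  normal⇒cut-free _ _ ax          _  = ax
  normal⇒cut-free _ _ (par d)     nf = par (normal⇒cut-free _ _ d (normal-below parᶜ nf))
  normal⇒cut-free _ _ (ten d e)   nf =
    ten (normal⇒cut-free _ _ d (normal-below tenˡ nf)) (normal⇒cut-free _ _ e (normal-below tenʳ nf))
  normal⇒cut-free _ _ (Q _ d)     nf = Q (normal⇒cut-free _ _ d (normal-below Qᶜ nf))
  normal⇒cut-free _ _ (perm d _)  nf = normal⇒cut-free _ _ d nf
  normal⇒cut-free _ _ (cut d e)   nf =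
    ⊥-elim (nf _ (proj₂ (cut-reducible (normal⇒cut-free _ _ d (normal-below cutˡ nf)) d
                                       (normal⇒cut-free _ _ e (normal-below cutʳ nf)) e)))

proposition1 : (L : LabelAlg) → let open QMLL L in
    (π : Proof) (Γ : List Formula) → π ⊢ Γ → Normal π → CutFree π
proposition1 L = CutFreeness.normal⇒cut-free L
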